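{- Let $\Delta$ be a positive integer and let $\mathcal{A}$ be Algorithm $\mathcal{A}(-1,\Delta+1)$ (defined in the context). For an integer $x\ge0$ let $$out(x)=\min_{\mathcal{I}:\ \alpha(\mathcal{I})=x}\ \mathbb{E}_{S\sim\Pi(\mathcal{I})}|OUT(\mathcal{A}(S))|,$$ the minimum over finite sets $\mathcal{I}$ of closed unit-length intervals contained in $[0,\Delta)$ whose maximum independent subset has size $\alpha(\mathcal{I})=x$, where $\Pi(\mathcal{I})$ is the uniform distribution over orderings of $\mathcal{I}$. Then for each $x\in\{0,1,2\}$ for which such instances exist, $out(x)=x$.
   Context: For closed intervals $I=[a_I,b_I]$, $J=[a_J,b_J]$: $I$ is further left than $J$ if $a_I<a_J$; $I$ is further right than $J$ if $b_I>b_J$; $I,J$ are independent if $I\cap J=\varnothing$. Algorithm $\mathcal{A}(a,b)$, for integers $a<b$, processes a stream of closed unit-length intervals each contained in $[a,b)$. At initialisation, for each integer $i\in\{a+1,\dots,b-1\}$ it sets $L_i\gets\emptyset$, $R_i\gets\emptyset$ and creates recursive instances $\mathcal{T}^L_i$, $\mathcal{A}^L_i$ of $\mathcal{A}(a,i)$ and $\mathcal{T}^R_i$, $\mathcal{A}^R_i$ of $\mathcal{A}(i,b)$. When an interval $I$ arrives, for each such $i$: if $I\subseteq[i,b)$: feed $I$ into $\mathcal{T}^R_i$; if $R_i=\emptyset$ or $I$ is further left than $R_i$, set $R_i\gets I$; then if $R_i\ne\emptyset$, $I$ is independent of $R_i$ and further right than $R_i$, feed $I$ into $\mathcal{A}^R_i$.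 If $I\subseteq[a,i)$: feed $I$ into $\mathcal{T}^L_i$; if $L_i=\emptyset$ or $I$ is further right than $L_i$, set $L_i\gets I$; then if $L_i\ne\emptyset$, $I$ is independent of $L_i$ and further left than $L_i$, feed $I$ into $\mathcal{A}^L_i$. The output $OUT(\mathcal{A})$ is a largest set among $OUT(\mathcal{T}^L_i)\cup R_i\cup OUT(\mathcal{A}^R_i)$ and $OUT(\mathcal{A}^L_i)\cup L_i\cup OUT(\mathcal{T}^R_i)$ over all $i$ (empty variables contribute nothing; empty output if no such $i$).
   Formalization: The closed unit-length intervals in the sets $\mathcal{I}$ have rational endpoints. -}

module Defs where

open import Data.Bool using (Bool; true; false; if_then_else_; _∧_; _∨_; not)
open import Data.Maybe using (Maybe; just; nothing)
open import Data.List using (List; []; _∷_; _++_; map; foldl; foldr; concatMap; length; upTo)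
open import Data.Nat.ListAction using (sum)
open import Data.List.Relation.Unary.All using (All)
open import Data.List.Relation.Unary.AllPairs using (AllPairs)
open import Data.List.Relation.Unary.Unique.Propositional using (Unique)
open import Data.List.Relation.Binary.Sublist.Propositional using (_⊆_)
open import Data.Nat as ℕ using (ℕ; zero; suc; _∸_; _!)
open import Data.Nat.Properties using (_!≢0)
open import Data.Integer as ℤ using (ℤ; +_)
open import Data.Rational using (ℚ; _/_; _<_; _≤_; 0ℚ; 1ℚ; _+_)
open import Data.Rational.Properties using (_<?_; _≤?_)
open import Data.Product using (Σ; _×_)
open import Data.Sum using (_⊎_)
open import Relation.Nullary using (does)
open import Relation.Binary.PropositionalEquality using (_≡_)

-- Intervals.  A closed unit-length interval [x, x+1] is represented by
-- its left endpoint x : ℚ.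

Interval : Set
Interval = ℚ

right : Interval → ℚ
right x = x + 1ℚ

fromℤ : ℤ → ℚ
fromℤ z = z / 1

_<ᵇ_ : ℚ → ℚ → Bool
p <ᵇ q = does (p <? q)

_≤ᵇ_ : ℚ → ℚ → Bool
p ≤ᵇ q = does (p ≤? q)

insideᵇ : ℚ → ℚ → Interval → Bool
insideᵇ lo hi x = (lo ≤ᵇ x) ∧ (right x <ᵇ hi)

independentᵇ : Interval → Interval → Bool
independentᵇ x y = (right x <ᵇ y) ∨ (right y <ᵇ x)

furtherLeftᵇ : Interval → Interval → Bool
furtherLeftᵇ x y = x <ᵇ y

furtherRightᵇ : Interval → Interval → Bool
furtherRightᵇ x y = right y <ᵇ right x

-- The recursive instances are deterministic functions
-- of the stream fed to them, so "feeding I into an instance" is modelled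
-- by appending I to that instance's input stream; at the end each
-- instance is run on its accumulated stream.

record SplitState : Set where
  constructor mkState
  field
    L  : Maybe Interval
    R  : Maybe Interval
    TL : List Interval
    AL : List Interval
    TR : List Interval
    AR : List Interval

initState : SplitState
initState = mkState nothing nothing [] [] [] []

stepR : ℚ → ℚ → SplitState → Interval → SplitState
stepR mid hi (mkState L R TL AL TR AR) x =
  if insideᵇ mid hi x
  then feed (updR R)
  else mkState L R TL AL TR AR
  where
  updR : Maybe Interval → Maybe Interval
  updR nothing  = just x
  updR (just r) = if furtherLeftᵇ x r then just x else just r
  feed : Maybe Interval → SplitState
  feed nothing  = mkState L nothing TL AL (TR ++ (x ∷ [])) AR
  feed (just r) = mkState L (just r) TL AL (TR ++ (x ∷ []))
    (if independentᵇ x r ∧ furtherRightᵇ x r then AR ++ (x ∷ []) else AR)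

stepL : ℚ → ℚ → SplitState → Interval → SplitState
stepL lo mid (mkState L R TL AL TR AR) x =
  if insideᵇ lo mid x
  then feed (updL L)
  else mkState L R TL AL TR AR
  where
  updL : Maybe Interval → Maybe Interval
  updL nothing  = just x
  updL (just l) = if furtherRightᵇ x l then just x else just l
  feed : Maybe Interval → SplitState
  feed nothing  = mkState nothing R (TL ++ (x ∷ [])) AL TR AR
  feed (just l) = mkState (just l) R (TL ++ (x ∷ []))
    (if independentᵇ x l ∧ furtherLeftᵇ x l then AL ++ (x ∷ []) else AL) TR AR

step : ℚ → ℚ → ℚ → SplitState → Interval → SplitState
step lo mid hi st x = stepL lo mid (stepR mid hi st x) x

maybeList : Maybe Interval → List Interval
maybeList nothing  = []
maybeList (just x) = x ∷ []

largest : List (List Interval) → List Interval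
largest = foldr pick []
  where
  pick : List Interval → List Interval → List Interval
  pick c best = if ℕ._<ᵇ_ (length c) (length best) then best else c

-- alg fuel a n S = OUT(A(a, a+n)) after processing stream S.
-- The integers i ∈ {a+1,…,b-1} are i = a + k, k ∈ {1,…,n-1};
-- A(a,i) has width k, A(i,b) has width n ∸ k.  The fuel argument only
-- ensures termination; it is always ≥ the width when called via OUT.
alg : ℕ → ℤ → ℕ → List Interval → List Interval
alg zero    a n S = []
alg (suc f) a n S = largest (concatMap candidates (map suc (upTo (n ∸ 1))))
  where
  candidates : ℕ → List (List Interval)
  candidates k = c1 ∷ c2 ∷ []
    where
    i  = a ℤ.+ (+ k)
    st = foldl (step (fromℤ a) (fromℤ i) (fromℤ (a ℤ.+ (+ n)))) initState S
    open SplitState st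
    c1 = alg f a k TL ++ maybeList R ++ alg f i (n ∸ k) AR
    c2 = alg f a k AL ++ maybeList L ++ alg f i (n ∸ k) TR

OUT : ℕ → List Interval → List Interval
OUT Δ S = alg (Δ ℕ.+ 2) (ℤ.- (+ 1)) (Δ ℕ.+ 2) S

insertAll : {A : Set} → A → List A → List (List A)
insertAll x []       = (x ∷ []) ∷ []
insertAll x (y ∷ ys) = (x ∷ y ∷ ys) ∷ map (y ∷_) (insertAll x ys)

perms : {A : Set} → List A → List (List A)
perms []       = [] ∷ []
perms (x ∷ xs) = concatMap (insertAll x) (perms xs)

expectedOut : ℕ → List Interval → ℚ
expectedOut Δ I =
  (+ sum (map (λ S → length (OUT Δ S)) (perms I))) / (length I !)
  where instance _ = length I !≢0

ValidInstance : ℕ → List Interval → Set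
ValidInstance Δ I = Unique I × All (λ x → 0ℚ ≤ x × right x < fromℤ (+ Δ)) I

Independent : Interval → Interval → Set
Independent x y = right x < y ⊎ right y < x

IndependentSet : List Interval → Set
IndependentSet = AllPairs Independent

HasAlpha : List Interval → ℕ → Set
HasAlpha I x =
  Σ (List Interval) (λ S → S ⊆ I × IndependentSet S × length S ≡ x)
  × ((S : List Interval) → S ⊆ I → IndependentSet S → length S ℕ.≤ x)

-- Lower bound: fix an ordering of the instance and an independent set K of size x ≤ 2 in
-- it. If x = 1, the interval of K lies right of split point 0 of A(-1, Δ+1), so R₀ ends up
-- nonempty. If x = 2, let r lie entirely left of ℓ in K. Once some interval has reached R₀,
-- R₀ only moves further left, and L_Δ only further right. So if r arrives first, ℓ later
-- finds R₀ entirely to its left and is fed to A^R₀ = A(0, Δ+1), where it makes L_Δ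
-- nonempty: the candidate R₀ ∪ OUT(A^R₀) has two elements. If ℓ arrives first, r is fed
-- to A^L_Δ = A(-1, Δ) in the same way, where it makes R₀ nonempty.
-- Upper bound: OUT never has more elements than its input, so the instance K itself has
-- expected output exactly x.

{-# OPTIONS --safe #-}
module Submission where

open import Defs
open import Data.Bool using (true; false; if_then_else_; _∧_; T)
open import Data.Bool.Properties using (∧-zeroʳ; ∨-zeroʳ)
open import Data.Empty using (⊥-elim)
open import Data.Maybe using (just; nothing)
import Data.Maybe.Relation.Unary.Any as Maybe
open import Data.Nat as ℕ using (ℕ; zero; suc; z≤n; s≤s; _∸_; _!)
import Data.Nat.Properties as ℕ
open import Data.Nat.ListAction using (sum)
open import Data.Integer as ℤ using (ℤ; +_; -[1+_])
import Data.Integer.Properties as ℤ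
open import Data.Rational using (ℚ; _/_; 0ℚ; 1ℚ; _≤_; _<_; *<*)
open import Data.Rational.Properties using (_<?_; _≤?_)
import Data.Rational.Properties as ℚ
import Data.Rational.Unnormalised as ℚᵘ
import Data.Rational.Unnormalised.Properties as ℚᵘ
open import Data.List using (List; []; _∷_; _++_; _∷ʳ_; length; foldl; map; concatMap; upTo)
open import Data.List.Properties using (length-++; length-map; foldl-++)
open import Data.List.Membership.Propositional using (_∈_; find)
open import Data.List.Membership.Propositional.Properties
  using (∈-++⁺ˡ; ∈-++⁺ʳ; ∈-∃++; ∈-map⁺; ∈-map⁻; ∈-upTo⁺; ∈-concatMap⁺; ∈-concatMap⁻)
open import Data.List.Relation.Binary.Subset.Propositional using () renaming (_⊆_ to _⊑_)
open import Data.List.Relation.Binary.Sublist.Propositional using (_⊆_; ⊆-refl)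
import Data.List.Relation.Binary.Sublist.Propositional as Sublist
open import Data.List.Relation.Binary.Sublist.Propositional.Properties using (All-resp-⊆; length-mono-≤)
open import Data.List.Relation.Binary.Permutation.Propositional
  using (_↭_; ↭-refl; ↭-prep; ↭-swap; ↭-trans; ↭-sym)
open import Data.List.Relation.Binary.Permutation.Propositional.Properties
  using (∈-resp-↭; All-resp-↭; ↭-length)
open import Data.List.Relation.Unary.Any using (Any; here; there)
import Data.List.Relation.Unary.Any as Any
open import Data.List.Relation.Unary.All using (All; []; _∷_)
import Data.List.Relation.Unary.All as All
import Data.List.Relation.Unary.All.Properties as All
open import Data.List.Relation.Unary.AllPairs using ([]; _∷_)
import Data.List.Relation.Unary.AllPairs as AllPairs
open import Data.Product using (Σ; ∃₂; _×_; _,_; proj₁; proj₂)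
open import Data.Sum using (_⊎_; inj₁; inj₂; [_,_]′)
open import Function using (_∘_; _$_)
open import Relation.Nullary using (Dec; ¬_; yes; no; does)
open import Relation.Nullary.Decidable using (dec-true; dec-false)
open import Relation.Binary.PropositionalEquality

open SplitState

private variable
  p q lo mid hi lo′ hi′ : ℚ
  x y : Interval

does⇒ : ∀ {A : Set} (a? : Dec A) → does a? ≡ true → A
does⇒ (yes a) _ = a

¬does⇒¬ : ∀ {A : Set} (a? : Dec A) → does a? ≡ false → ¬ A
¬does⇒¬ (no ¬a) _ = ¬a

<ᵇ⇒< : p <ᵇ q ≡ true → p < q
<ᵇ⇒< {p} {q} = does⇒ (p <? q)

<ᵇ≡false⇒≮ : p <ᵇ q ≡ false → ¬ p < q
<ᵇ≡false⇒≮ {p} {q} = ¬does⇒¬ (p <? q)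

<⇒<ᵇ : p < q → p <ᵇ q ≡ true
<⇒<ᵇ {p} {q} = dec-true (p <? q)

≮⇒<ᵇ≡false : ¬ p < q → p <ᵇ q ≡ false
≮⇒<ᵇ≡false {p} {q} = dec-false (p <? q)

≤ᵇ⇒≤ : p ≤ᵇ q ≡ true → p ≤ q
≤ᵇ⇒≤ {p} {q} = does⇒ (p ≤? q)

≤⇒≤ᵇ : p ≤ q → p ≤ᵇ q ≡ true
≤⇒≤ᵇ {p} {q} = dec-true (p ≤? q)

<-right : ∀ p → p < right p
<-right p = subst (_< right p) (ℚ.+-identityʳ p) (ℚ.+-monoʳ-< p (*<* (ℤ.+<+ (s≤s z≤n))))

right-mono-< : p < q → right p < right q
right-mono-< = ℚ.+-monoˡ-< 1ℚ

right-mono-≤ : p ≤ q → right p ≤ right q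
right-mono-≤ = ℚ.+-monoˡ-≤ 1ℚ

right-cancel-< : right p < right q → p < q
right-cancel-< rp<rq = ℚ.≰⇒> (λ q≤p → ℚ.<-irrefl refl (ℚ.<-≤-trans rp<rq (right-mono-≤ q≤p)))

independentᵇ-irrefl : ∀ x → independentᵇ x x ≡ false
independentᵇ-irrefl x rewrite ≮⇒<ᵇ≡false (ℚ.<-asym (<-right x)) = refl

*≤*⇒/≤/ : ∀ i j m n .{{_ : ℕ.NonZero m}} .{{_ : ℕ.NonZero n}} →
          i ℤ.* + n ℤ.≤ j ℤ.* + m → i / m ≤ j / n
*≤*⇒/≤/ i j (suc m) (suc n) i*n≤j*m = ℚ.toℚᵘ-cancel-≤
  (ℚᵘ.≤-respʳ-≃ (ℚᵘ.≃-sym (ℚ.toℚᵘ-fromℚᵘ (ℚᵘ.mkℚᵘ j n)))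
    (ℚᵘ.≤-respˡ-≃ (ℚᵘ.≃-sym (ℚ.toℚᵘ-fromℚᵘ (ℚᵘ.mkℚᵘ i m))) (ℚᵘ.*≤* i*n≤j*m)))

fromℤ-mono-≤ : ∀ {i j} → i ℤ.≤ j → fromℤ i ≤ fromℤ j
fromℤ-mono-≤ {i} {j} i≤j =
  *≤*⇒/≤/ i j 1 1 (subst₂ ℤ._≤_ (sym (ℤ.*-identityʳ i)) (sym (ℤ.*-identityʳ j)) i≤j)

Inside : ℚ → ℚ → Interval → Set
Inside lo hi x = lo ≤ x × right x < hi

insideᵇ⇒Inside : insideᵇ lo hi x ≡ true → Inside lo hi x
insideᵇ⇒Inside {lo} {hi} {x} e with lo ≤ᵇ x in lo≤x | right x <ᵇ hi in x<hi
insideᵇ⇒Inside refl | true | true = ≤ᵇ⇒≤ lo≤x , <ᵇ⇒< x<hi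

Inside⇒insideᵇ : Inside lo hi x → insideᵇ lo hi x ≡ true
Inside⇒insideᵇ (lo≤x , x<hi) rewrite ≤⇒≤ᵇ lo≤x | <⇒<ᵇ x<hi = refl

Inside⇒¬outside : Inside lo hi x → ¬ insideᵇ lo hi x ≡ false
Inside⇒¬outside i e with () ← trans (sym (Inside⇒insideᵇ i)) e

Inside-weaken : lo′ ≤ lo → hi ≤ hi′ → Inside lo hi x → Inside lo′ hi′ x
Inside-weaken lo′≤lo hi≤hi′ (lo≤x , x<hi) = ℚ.≤-trans lo′≤lo lo≤x , ℚ.<-≤-trans x<hi hi≤hi′

Inside⇒outside-left : Inside mid hi x → insideᵇ lo mid x ≡ false
Inside⇒outside-left {mid} {x = x} {lo} (mid≤x , _)
  rewrite ≮⇒<ᵇ≡false (λ x<mid → ℚ.<-irrefl refl (ℚ.≤-<-trans mid≤x (ℚ.<-trans (<-right x) x<mid)))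
  = ∧-zeroʳ (lo ≤ᵇ x)

-- In the first and replace cases Defs also tests y for independence from itself, which
-- always fails (independentᵇ-irrefl), so AR is unchanged.
data StepR (mid hi : ℚ) (st : SplitState) (y : Interval) : SplitState → Set where
  outside : insideᵇ mid hi y ≡ false → StepR mid hi st y st
  first   : Inside mid hi y → R st ≡ nothing →
            StepR mid hi st y (record st { R = just y ; TR = TR st ∷ʳ y })
  replace : ∀ {r} → Inside mid hi y → R st ≡ just r → furtherLeftᵇ y r ≡ true →
            StepR mid hi st y (record st { R = just y ; TR = TR st ∷ʳ y })
  retain  : ∀ {r} → Inside mid hi y → R st ≡ just r → furtherLeftᵇ y r ≡ false →
            StepR mid hi st y (record st
              { TR = TR st ∷ʳ y
              ; AR = if independentᵇ y r ∧ furtherRightᵇ y r then AR st ∷ʳ y else AR st })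

stepR-view : ∀ mid hi st y → StepR mid hi st y (stepR mid hi st y)
stepR-view mid hi (mkState L nothing TL AL TR AR) y with insideᵇ mid hi y in inside
... | false = outside inside
... | true rewrite independentᵇ-irrefl y = first (insideᵇ⇒Inside inside) refl
stepR-view mid hi (mkState L (just r) TL AL TR AR) y with insideᵇ mid hi y in inside
... | false = outside inside
... | true with furtherLeftᵇ y r in further
...   | true rewrite independentᵇ-irrefl y = replace (insideᵇ⇒Inside inside) refl further
...   | false = retain (insideᵇ⇒Inside inside) refl further

data StepL (lo mid : ℚ) (st : SplitState) (y : Interval) : SplitState → Set where
  outside : insideᵇ lo mid y ≡ false → StepL lo mid st y st
  first   : Inside lo mid y → L st ≡ nothing →
            StepL lo mid st y (record st { L = just y ; TL = TL st ∷ʳ y })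
  replace : ∀ {l} → Inside lo mid y → L st ≡ just l → furtherRightᵇ y l ≡ true →
            StepL lo mid st y (record st { L = just y ; TL = TL st ∷ʳ y })
  retain  : ∀ {l} → Inside lo mid y → L st ≡ just l → furtherRightᵇ y l ≡ false →
            StepL lo mid st y (record st
              { TL = TL st ∷ʳ y
              ; AL = if independentᵇ y l ∧ furtherLeftᵇ y l then AL st ∷ʳ y else AL st })

stepL-view : ∀ lo mid st y → StepL lo mid st y (stepL lo mid st y)
stepL-view lo mid (mkState nothing R TL AL TR AR) y with insideᵇ lo mid y in inside
... | false = outside inside
... | true rewrite independentᵇ-irrefl y = first (insideᵇ⇒Inside inside) refl
stepL-view lo mid (mkState (just l) R TL AL TR AR) y with insideᵇ lo mid y in inside
... | false = outside inside
... | true with furtherRightᵇ y l in further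
...   | true rewrite independentᵇ-irrefl y = replace (insideᵇ⇒Inside inside) refl further
...   | false = retain (insideᵇ⇒Inside inside) refl further

length-∷ʳ : ∀ (xs : List Interval) y → length (xs ∷ʳ y) ≡ suc (length xs)
length-∷ʳ xs y = trans (length-++ xs) (ℕ.+-comm (length xs) 1)

length-∷ʳ-if : ∀ b (xs : List Interval) y → length (if b then xs ∷ʳ y else xs) ℕ.≤ suc (length xs)
length-∷ʳ-if true  xs y = ℕ.≤-reflexive (length-∷ʳ xs y)
length-∷ʳ-if false xs y = ℕ.n≤1+n (length xs)

-- Every interval in R or AR was fed to T^R (and mirror), and no interval is fed to both
-- T^L and T^R; together this bounds each candidate set of alg by the stream length.
fedT : SplitState → ℕ
fedT s = length (TL s) ℕ.+ length (TR s)

R+AR≤TR AL+L≤TL : SplitState → Set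
R+AR≤TR st = length (maybeList (R st)) ℕ.+ length (AR st) ℕ.≤ length (TR st)
AL+L≤TL st = length (AL st) ℕ.+ length (maybeList (L st)) ℕ.≤ length (TL st)

module _ (mid hi : ℚ) (st : SplitState) (y : Interval) where

  stepR-frame : record (stepR mid hi st y) { R = R st ; TR = TR st ; AR = AR st } ≡ st
  stepR-frame with stepR mid hi st y | stepR-view mid hi st y
  ... | _ | outside _     = refl
  ... | _ | first _ _     = refl
  ... | _ | replace _ _ _ = refl
  ... | _ | retain _ _ _  = refl

  stepR-keeps-R≤ : ∀ {r} → Maybe.Any (_≤ r) (R st) → Maybe.Any (_≤ r) (R (stepR mid hi st y))
  stepR-keeps-R≤ h with stepR mid hi st y | stepR-view mid hi st y
  ... | _ | outside _       = h
  ... | _ | first _ e       rewrite e with () ← h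
  ... | _ | replace _ e y<z rewrite e with Maybe.just z≤r ← h =
    Maybe.just (ℚ.<⇒≤ (ℚ.<-≤-trans (<ᵇ⇒< y<z) z≤r))
  ... | _ | retain _ _ _    = h

  stepR-sets-R≤ : Inside mid hi y → Maybe.Any (_≤ y) (R (stepR mid hi st y))
  stepR-sets-R≤ i with stepR mid hi st y | stepR-view mid hi st y
  ... | _ | outside o       = ⊥-elim (Inside⇒¬outside i o)
  ... | _ | first _ _       = Maybe.just ℚ.≤-refl
  ... | _ | replace _ _ _   = Maybe.just ℚ.≤-refl
  ... | _ | retain _ e y≮z  rewrite e = Maybe.just (ℚ.≮⇒≥ (<ᵇ≡false⇒≮ y≮z))

  stepR-keeps-AR : AR st ⊑ AR (stepR mid hi st y)
  stepR-keeps-AR w∈ with stepR mid hi st y | stepR-view mid hi st y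
  ... | _ | outside _     = w∈
  ... | _ | first _ _     = w∈
  ... | _ | replace _ _ _ = w∈
  ... | _ | retain {z} _ _ _ with independentᵇ y z ∧ furtherRightᵇ y z
  ...   | true  = ∈-++⁺ˡ w∈
  ...   | false = w∈

  stepR-feeds-AR : Inside mid hi y → Maybe.Any (λ z → right z < y) (R st) → y ∈ AR (stepR mid hi st y)
  stepR-feeds-AR i h with stepR mid hi st y | stepR-view mid hi st y
  ... | _ | outside o     = ⊥-elim (Inside⇒¬outside i o)
  ... | _ | first _ e     rewrite e with () ← h
  ... | _ | replace {z} _ e y<z rewrite e with Maybe.just z<y ← h =
    ⊥-elim (ℚ.<-asym (<ᵇ⇒< y<z) (ℚ.<-trans (<-right z) z<y))
  ... | _ | retain {z} _ e _ rewrite e with Maybe.just z<y ← h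
    rewrite <⇒<ᵇ z<y | ∨-zeroʳ (right y <ᵇ z) | <⇒<ᵇ (ℚ.<-trans z<y (<-right y)) =
    ∈-++⁺ʳ (AR st) (here refl)

  stepR-R+AR≤TR : R+AR≤TR st → R+AR≤TR (stepR mid hi st y)
  stepR-R+AR≤TR h with stepR mid hi st y | stepR-view mid hi st y
  ... | _ | outside _     = h
  ... | _ | first _ e     rewrite e | length-∷ʳ (TR st) y = s≤s h
  ... | _ | replace _ e _ rewrite e | length-∷ʳ (TR st) y = ℕ.m≤n⇒m≤1+n h
  ... | _ | retain {z} _ e _ rewrite e | length-∷ʳ (TR st) y =
    ℕ.≤-trans (ℕ.+-monoʳ-≤ 1 (length-∷ʳ-if (independentᵇ y z ∧ furtherRightᵇ y z) (AR st) y)) (s≤s h)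

  stepR-inside-TR : Inside mid hi y → TR (stepR mid hi st y) ≡ TR st ∷ʳ y
  stepR-inside-TR i with stepR mid hi st y | stepR-view mid hi st y
  ... | _ | outside o     = ⊥-elim (Inside⇒¬outside i o)
  ... | _ | first _ _     = refl
  ... | _ | replace _ _ _ = refl
  ... | _ | retain _ _ _  = refl

module _ (lo mid : ℚ) (st : SplitState) (y : Interval) where

  stepL-frame : record (stepL lo mid st y) { L = L st ; TL = TL st ; AL = AL st } ≡ st
  stepL-frame with stepL lo mid st y | stepL-view lo mid st y
  ... | _ | outside _     = refl
  ... | _ | first _ _     = refl
  ... | _ | replace _ _ _ = refl
  ... | _ | retain _ _ _  = refl

  stepL-keeps-≤L : ∀ {ℓ} → Maybe.Any (ℓ ≤_) (L st) → Maybe.Any (ℓ ≤_) (L (stepL lo mid st y))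
  stepL-keeps-≤L h with stepL lo mid st y | stepL-view lo mid st y
  ... | _ | outside _       = h
  ... | _ | first _ e       rewrite e with () ← h
  ... | _ | replace _ e w<y rewrite e with Maybe.just ℓ≤w ← h =
    Maybe.just (ℚ.<⇒≤ (ℚ.≤-<-trans ℓ≤w (right-cancel-< (<ᵇ⇒< w<y))))
  ... | _ | retain _ _ _    = h

  stepL-sets-≤L : Inside lo mid y → Maybe.Any (y ≤_) (L (stepL lo mid st y))
  stepL-sets-≤L i with stepL lo mid st y | stepL-view lo mid st y
  ... | _ | outside o       = ⊥-elim (Inside⇒¬outside i o)
  ... | _ | first _ _       = Maybe.just ℚ.≤-refl
  ... | _ | replace _ _ _   = Maybe.just ℚ.≤-refl
  ... | _ | retain _ e w≮y  rewrite e = Maybe.just (ℚ.≮⇒≥ (<ᵇ≡false⇒≮ w≮y ∘ right-mono-<))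

  stepL-keeps-AL : AL st ⊑ AL (stepL lo mid st y)
  stepL-keeps-AL w∈ with stepL lo mid st y | stepL-view lo mid st y
  ... | _ | outside _     = w∈
  ... | _ | first _ _     = w∈
  ... | _ | replace _ _ _ = w∈
  ... | _ | retain {w} _ _ _ with independentᵇ y w ∧ furtherLeftᵇ y w
  ...   | true  = ∈-++⁺ˡ w∈
  ...   | false = w∈

  stepL-feeds-AL : Inside lo mid y → Maybe.Any (λ w → right y < w) (L st) → y ∈ AL (stepL lo mid st y)
  stepL-feeds-AL i h with stepL lo mid st y | stepL-view lo mid st y
  ... | _ | outside o     = ⊥-elim (Inside⇒¬outside i o)
  ... | _ | first _ e     rewrite e with () ← h
  ... | _ | replace {w} _ e w<y rewrite e with Maybe.just y<w ← h =
    ⊥-elim (ℚ.<-asym (<ᵇ⇒< w<y) (right-mono-< (ℚ.<-trans (<-right y) y<w)))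
  ... | _ | retain {w} _ e _ rewrite e with Maybe.just y<w ← h
    rewrite <⇒<ᵇ y<w | <⇒<ᵇ (ℚ.<-trans (<-right y) y<w) = ∈-++⁺ʳ (AL st) (here refl)

  stepL-AL+L≤TL : AL+L≤TL st → AL+L≤TL (stepL lo mid st y)
  stepL-AL+L≤TL h with stepL lo mid st y | stepL-view lo mid st y
  ... | _ | outside _     = h
  ... | _ | first _ e     rewrite e | length-∷ʳ (TL st) y =
    ℕ.≤-trans (ℕ.≤-reflexive (ℕ.+-suc (length (AL st)) 0)) (s≤s h)
  ... | _ | replace _ e _ rewrite e | length-∷ʳ (TL st) y = ℕ.m≤n⇒m≤1+n h
  ... | _ | retain {w} _ e _ rewrite e | length-∷ʳ (TL st) y =
    ℕ.≤-trans (ℕ.+-monoˡ-≤ 1 (length-∷ʳ-if (independentᵇ y w ∧ furtherLeftᵇ y w) (AL st) y)) (s≤s h)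

  stepL-TL-≤ : length (TL (stepL lo mid st y)) ℕ.≤ suc (length (TL st))
  stepL-TL-≤ with stepL lo mid st y | stepL-view lo mid st y
  ... | _ | outside _     = ℕ.n≤1+n _
  ... | _ | first _ _     = ℕ.≤-reflexive (length-∷ʳ (TL st) y)
  ... | _ | replace _ _ _ = ℕ.≤-reflexive (length-∷ʳ (TL st) y)
  ... | _ | retain _ _ _  = ℕ.≤-reflexive (length-∷ʳ (TL st) y)

stepL-outside : ∀ lo mid st y → insideᵇ lo mid y ≡ false → stepL lo mid st y ≡ st
stepL-outside lo mid (mkState L R TL AL TR AR) y e rewrite e = refl

stepR-outside : ∀ mid hi st y → insideᵇ mid hi y ≡ false → stepR mid hi st y ≡ st
stepR-outside mid hi (mkState L R TL AL TR AR) y e rewrite e = refl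

module _ (lo mid hi : ℚ) (st : SplitState) (y : Interval) where
  private
    st′ : SplitState
    st′ = stepR mid hi st y

    right-fields : st′ ≡ record (step lo mid hi st y) { L = L st′ ; TL = TL st′ ; AL = AL st′ }
    right-fields = sym (stepL-frame lo mid st′ y)

    left-fields : st ≡ record st′ { R = R st ; TR = TR st ; AR = AR st }
    left-fields = sym (stepR-frame mid hi st y)

  step-keeps-R≤ : ∀ {r} → Maybe.Any (_≤ r) (R st) → Maybe.Any (_≤ r) (R (step lo mid hi st y))
  step-keeps-R≤ {r} h = subst (Maybe.Any (_≤ r) ∘ R) right-fields (stepR-keeps-R≤ mid hi st y h)

  step-sets-R≤ : Inside mid hi y → Maybe.Any (_≤ y) (R (step lo mid hi st y))
  step-sets-R≤ i = subst (Maybe.Any (_≤ y) ∘ R) right-fields (stepR-sets-R≤ mid hi st y i)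

  step-keeps-AR : AR st ⊑ AR (step lo mid hi st y)
  step-keeps-AR w∈ = subst (λ s → _ ∈ AR s) right-fields (stepR-keeps-AR mid hi st y w∈)

  step-feeds-AR : Inside mid hi y → Maybe.Any (λ z → right z < y) (R st) → y ∈ AR (step lo mid hi st y)
  step-feeds-AR i h = subst (λ s → y ∈ AR s) right-fields (stepR-feeds-AR mid hi st y i h)

  step-R+AR≤TR : R+AR≤TR st → R+AR≤TR (step lo mid hi st y)
  step-R+AR≤TR h = subst R+AR≤TR right-fields (stepR-R+AR≤TR mid hi st y h)

  step-keeps-≤L : ∀ {ℓ} → Maybe.Any (ℓ ≤_) (L st) → Maybe.Any (ℓ ≤_) (L (step lo mid hi st y))
  step-keeps-≤L {ℓ} h = stepL-keeps-≤L lo mid st′ y (subst (Maybe.Any (ℓ ≤_) ∘ L) left-fields h)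

  step-sets-≤L : Inside lo mid y → Maybe.Any (y ≤_) (L (step lo mid hi st y))
  step-sets-≤L = stepL-sets-≤L lo mid st′ y

  step-keeps-AL : AL st ⊑ AL (step lo mid hi st y)
  step-keeps-AL w∈ = stepL-keeps-AL lo mid st′ y (subst (λ s → _ ∈ AL s) left-fields w∈)

  step-feeds-AL : Inside lo mid y → Maybe.Any (λ w → right y < w) (L st) → y ∈ AL (step lo mid hi st y)
  step-feeds-AL i h =
    stepL-feeds-AL lo mid st′ y i (subst (Maybe.Any (λ w → right y < w) ∘ L) left-fields h)

  step-AL+L≤TL : AL+L≤TL st → AL+L≤TL (step lo mid hi st y)
  step-AL+L≤TL h = stepL-AL+L≤TL lo mid st′ y (subst AL+L≤TL left-fields h)

  step-fedT : fedT (step lo mid hi st y) ℕ.≤ suc (fedT st)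
  step-fedT = by-side (insideᵇ mid hi y) refl
    where
    open ℕ.≤-Reasoning
    by-side : ∀ b → insideᵇ mid hi y ≡ b → fedT (step lo mid hi st y) ℕ.≤ suc (fedT st)
    by-side true e = begin
      fedT (step lo mid hi st y)
        ≡⟨ cong fedT (stepL-outside lo mid st′ y (Inside⇒outside-left {lo = lo} i)) ⟩
      fedT st′
        ≡⟨ cong₂ (λ xs ys → length xs ℕ.+ length ys)
                 (cong TL (stepR-frame mid hi st y)) (stepR-inside-TR mid hi st y i) ⟩
      length (TL st) ℕ.+ length (TR st ∷ʳ y)
        ≡⟨ cong (length (TL st) ℕ.+_) (length-∷ʳ (TR st) y) ⟩
      length (TL st) ℕ.+ suc (length (TR st))
        ≡⟨ ℕ.+-suc (length (TL st)) (length (TR st)) ⟩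
      suc (fedT st) ∎
      where
      i : Inside mid hi y
      i = insideᵇ⇒Inside e
    by-side false e = begin
      fedT (step lo mid hi st y)
        ≡⟨ cong (λ s → fedT (stepL lo mid s y)) (stepR-outside mid hi st y e) ⟩
      fedT (stepL lo mid st y)
        ≡⟨ cong (λ xs → length (TL (stepL lo mid st y)) ℕ.+ length xs)
                (cong TR (stepL-frame lo mid st y)) ⟩
      length (TL (stepL lo mid st y)) ℕ.+ length (TR st)
        ≤⟨ ℕ.+-monoˡ-≤ (length (TR st)) (stepL-TL-≤ lo mid st y) ⟩
      suc (fedT st) ∎

module _ {A B : Set} {f : B → A → B} where

  foldl-preserves : (P : B → Set) → (∀ b a → P b → P (f b a)) → ∀ b xs → P b → P (foldl f b xs)
  foldl-preserves P pres b []       pb = pb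
  foldl-preserves P pres b (a ∷ xs) pb = foldl-preserves P pres (f b a) xs (pres b a pb)

  foldl-at : ∀ b {v xs} → v ∈ xs → ∃₂ λ ys zs → foldl f b xs ≡ foldl f (f (foldl f b ys) v) zs
  foldl-at b v∈xs with ys , zs , refl ← ∈-∃++ v∈xs = ys , zs , foldl-++ f b ys (_ ∷ zs)

Precedes : ∀ {A : Set} → A → A → List A → Set
Precedes x y xs = ∃₂ λ ys zs → xs ≡ ys ++ x ∷ zs × y ∈ zs

∈-precedes : ∀ {A : Set} {x y : A} {xs} → x ∈ xs → y ∈ xs → x ≢ y → Precedes x y xs ⊎ Precedes y x xs
∈-precedes (here refl) (here refl) x≢y = ⊥-elim (x≢y refl)
∈-precedes (here refl) (there y∈) _   = inj₁ ([] , _ , refl , y∈)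
∈-precedes (there x∈) (here refl) _   = inj₂ ([] , _ , refl , x∈)
∈-precedes {xs = z ∷ _} (there x∈) (there y∈) x≢y with ∈-precedes x∈ y∈ x≢y
... | inj₁ (ys , zs , refl , y∈zs) = inj₁ (z ∷ ys , zs , refl , y∈zs)
... | inj₂ (ys , zs , refl , x∈zs) = inj₂ (z ∷ ys , zs , refl , x∈zs)

Precedes⇒∈ : ∀ {A : Set} {x y : A} {xs} → Precedes x y xs → x ∈ xs
Precedes⇒∈ (ys , _ , refl , _) = ∈-++⁺ʳ ys (here refl)

module Run (lo mid hi : ℚ) where

  run : SplitState → List Interval → SplitState
  run = foldl (step lo mid hi)

  R≤-after : ∀ st {S r} → r ∈ S → Inside mid hi r → Maybe.Any (_≤ r) (R (run st S))
  R≤-after st {r = r} r∈S i with A , B , eq ← foldl-at st r∈S =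
    subst (Maybe.Any (_≤ r) ∘ R) (sym eq) $
    foldl-preserves (Maybe.Any (_≤ r) ∘ R) (λ s y → step-keeps-R≤ lo mid hi s y) _ B
      (step-sets-R≤ lo mid hi (run st A) r i)

  AR-after : ∀ st {S r ℓ} → Maybe.Any (_≤ r) (R st) → right r < ℓ →
             ℓ ∈ S → Inside mid hi ℓ → ℓ ∈ AR (run st S)
  AR-after st {r = r} {ℓ} r≤ r<ℓ ℓ∈S i with A , B , eq ← foldl-at st ℓ∈S =
    subst (λ s → ℓ ∈ AR s) (sym eq) $
    foldl-preserves (λ s → ℓ ∈ AR s) (λ s y → step-keeps-AR lo mid hi s y) _ B
      (step-feeds-AR lo mid hi (run st A) ℓ i
        (Maybe.map (λ z≤r → ℚ.≤-<-trans (right-mono-≤ z≤r) r<ℓ) R≤-before))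
    where
    R≤-before : Maybe.Any (_≤ r) (R (run st A))
    R≤-before = foldl-preserves (Maybe.Any (_≤ r) ∘ R) (λ s y → step-keeps-R≤ lo mid hi s y) st A r≤

  ≤L-after : ∀ st {S ℓ} → ℓ ∈ S → Inside lo mid ℓ → Maybe.Any (ℓ ≤_) (L (run st S))
  ≤L-after st {ℓ = ℓ} ℓ∈S i with A , B , eq ← foldl-at st ℓ∈S =
    subst (Maybe.Any (ℓ ≤_) ∘ L) (sym eq) $
    foldl-preserves (Maybe.Any (ℓ ≤_) ∘ L) (λ s y → step-keeps-≤L lo mid hi s y) _ B
      (step-sets-≤L lo mid hi (run st A) ℓ i)

  AL-after : ∀ st {S r ℓ} → Maybe.Any (ℓ ≤_) (L st) → right r < ℓ →
             r ∈ S → Inside lo mid r → r ∈ AL (run st S)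
  AL-after st {r = r} {ℓ} ≤ℓ r<ℓ r∈S i with A , B , eq ← foldl-at st r∈S =
    subst (λ s → r ∈ AL s) (sym eq) $
    foldl-preserves (λ s → r ∈ AL s) (λ s y → step-keeps-AL lo mid hi s y) _ B
      (step-feeds-AL lo mid hi (run st A) r i (Maybe.map (λ ℓ≤w → ℚ.<-≤-trans r<ℓ ℓ≤w) ≤L-before))
    where
    ≤L-before : Maybe.Any (ℓ ≤_) (L (run st A))
    ≤L-before = foldl-preserves (Maybe.Any (ℓ ≤_) ∘ L) (λ s y → step-keeps-≤L lo mid hi s y) st A ≤ℓ

  feeds-AR : ∀ st {S r ℓ} → Precedes r ℓ S → Inside mid hi r → Inside mid hi ℓ → right r < ℓ →
             ℓ ∈ AR (run st S)
  feeds-AR st {r = r} {ℓ} (A , B , refl , ℓ∈B) ir iℓ r<ℓ =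
    subst (λ s → ℓ ∈ AR s) (sym (foldl-++ (step lo mid hi) st A (r ∷ B))) $
    AR-after _ (step-sets-R≤ lo mid hi (run st A) _ ir) r<ℓ ℓ∈B iℓ

  feeds-AL : ∀ st {S r ℓ} → Precedes ℓ r S → Inside lo mid ℓ → Inside lo mid r → right r < ℓ →
             r ∈ AL (run st S)
  feeds-AL st {r = r} {ℓ} (A , B , refl , r∈B) iℓ ir r<ℓ =
    subst (λ s → r ∈ AL s) (sym (foldl-++ (step lo mid hi) st A (ℓ ∷ B))) $
    AL-after _ (step-sets-≤L lo mid hi (run st A) _ iℓ) r<ℓ r∈B ir

  run-R+AR≤TR : ∀ st S → R+AR≤TR st → R+AR≤TR (run st S)
  run-R+AR≤TR = foldl-preserves R+AR≤TR (step-R+AR≤TR lo mid hi)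

  run-AL+L≤TL : ∀ st S → AL+L≤TL st → AL+L≤TL (run st S)
  run-AL+L≤TL = foldl-preserves AL+L≤TL (step-AL+L≤TL lo mid hi)

  run-fedT : ∀ st S → fedT (run st S) ℕ.≤ length S ℕ.+ fedT st
  run-fedT st []      = ℕ.≤-refl
  run-fedT st (y ∷ S) = ℕ.≤-trans (run-fedT (step lo mid hi st y) S) $
    ℕ.≤-trans (ℕ.+-monoʳ-≤ (length S) (step-fedT lo mid hi st y))
              (ℕ.≤-reflexive (ℕ.+-suc (length S) (fedT st)))

splitPoints : ℕ → List ℕ
splitPoints n = map suc (upTo (n ∸ 1))

suc-∈-splitPoints : ∀ {j n} → j ℕ.< n → suc j ∈ splitPoints (suc n)
suc-∈-splitPoints j<n = ∈-map⁺ suc (∈-upTo⁺ j<n)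

splitState : ℤ → ℕ → List Interval → ℕ → SplitState
splitState a n S k = Run.run (fromℤ a) (fromℤ (a ℤ.+ + k)) (fromℤ (a ℤ.+ + n)) initState S

-- alg (suc f) a n S is definitionally largest (concatMap (candidates f a n S) (splitPoints n)).
candidates : ℕ → ℤ → ℕ → List Interval → ℕ → List (List Interval)
candidates f a n S k =
    (alg f a k (TL st) ++ maybeList (R st) ++ alg f (a ℤ.+ + k) (n ∸ k) (AR st))
  ∷ (alg f a k (AL st) ++ maybeList (L st) ++ alg f (a ℤ.+ + k) (n ∸ k) (TR st))
  ∷ []
  where st = splitState a n S k

length-largest-≤ : ∀ {m} cs → All (λ c → length c ℕ.≤ m) cs → length (largest cs) ℕ.≤ m
length-largest-≤ []       []         = z≤n
length-largest-≤ (c ∷ cs) (c≤m ∷ cs≤m) with ℕ._<ᵇ_ (length c) (length (largest cs))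
... | true  = length-largest-≤ cs cs≤m
... | false = c≤m

length-≤-largest : ∀ {c} cs → c ∈ cs → length c ℕ.≤ length (largest cs)
length-≤-largest (d ∷ cs) c∈ with ℕ._<ᵇ_ (length d) (length (largest cs)) in d<
length-≤-largest (d ∷ cs) (here refl) | true  = ℕ.<⇒≤ (ℕ.<ᵇ⇒< _ _ (subst T (sym d<) _))
length-≤-largest (d ∷ cs) (there c∈)  | true  = length-≤-largest cs c∈
length-≤-largest (d ∷ cs) (here refl) | false = ℕ.≤-refl
length-≤-largest (d ∷ cs) (there c∈)  | false =
  ℕ.≤-trans (length-≤-largest cs c∈) (ℕ.≮⇒≥ (λ lt → subst T d< (ℕ.<⇒<ᵇ lt)))

length-++³ : ∀ (xs ys zs : List Interval) →
             length (xs ++ ys ++ zs) ≡ length xs ℕ.+ (length ys ℕ.+ length zs)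
length-++³ xs ys zs = trans (length-++ xs) (cong (length xs ℕ.+_) (length-++ ys))

splitState-bounds : ∀ a n S k → R+AR≤TR (splitState a n S k) × AL+L≤TL (splitState a n S k)
                                × fedT (splitState a n S k) ℕ.≤ length S
splitState-bounds a n S k =
    run-R+AR≤TR initState S z≤n
  , run-AL+L≤TL initState S z≤n
  , ℕ.≤-trans (run-fedT initState S) (ℕ.≤-reflexive (ℕ.+-identityʳ (length S)))
  where open Run (fromℤ a) (fromℤ (a ℤ.+ + k)) (fromℤ (a ℤ.+ + n))

candidates-length-≤ : ∀ f a n S k → (∀ a′ n′ T → length (alg f a′ n′ T) ℕ.≤ length T) →
                      All (λ c → length c ℕ.≤ length S) (candidates f a n S k)
candidates-length-≤ f a n S k alg-f-≤ = first-≤ ∷ second-≤ ∷ []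
  where
  st = splitState a n S k
  i  = a ℤ.+ + k
  open ℕ.≤-Reasoning
  bounds = splitState-bounds a n S k

  first-≤ : length (alg f a k (TL st) ++ maybeList (R st) ++ alg f i (n ∸ k) (AR st)) ℕ.≤ length S
  first-≤ = begin
    length (alg f a k (TL st) ++ maybeList (R st) ++ alg f i (n ∸ k) (AR st))
      ≡⟨ length-++³ (alg f a k (TL st)) (maybeList (R st)) (alg f i (n ∸ k) (AR st)) ⟩
    length (alg f a k (TL st)) ℕ.+ (length (maybeList (R st)) ℕ.+ length (alg f i (n ∸ k) (AR st)))
      ≤⟨ ℕ.+-mono-≤ (alg-f-≤ a k (TL st))
                    (ℕ.+-monoʳ-≤ (length (maybeList (R st))) (alg-f-≤ i (n ∸ k) (AR st))) ⟩
    length (TL st) ℕ.+ (length (maybeList (R st)) ℕ.+ length (AR st))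
      ≤⟨ ℕ.+-monoʳ-≤ (length (TL st)) (proj₁ bounds) ⟩
    fedT st
      ≤⟨ proj₂ (proj₂ bounds) ⟩
    length S ∎

  second-≤ : length (alg f a k (AL st) ++ maybeList (L st) ++ alg f i (n ∸ k) (TR st)) ℕ.≤ length S
  second-≤ = begin
    length (alg f a k (AL st) ++ maybeList (L st) ++ alg f i (n ∸ k) (TR st))
      ≡⟨ length-++³ (alg f a k (AL st)) (maybeList (L st)) (alg f i (n ∸ k) (TR st)) ⟩
    length (alg f a k (AL st)) ℕ.+ (length (maybeList (L st)) ℕ.+ length (alg f i (n ∸ k) (TR st)))
      ≤⟨ ℕ.+-mono-≤ (alg-f-≤ a k (AL st))
                    (ℕ.+-monoʳ-≤ (length (maybeList (L st))) (alg-f-≤ i (n ∸ k) (TR st))) ⟩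
    length (AL st) ℕ.+ (length (maybeList (L st)) ℕ.+ length (TR st))
      ≡⟨ ℕ.+-assoc (length (AL st)) (length (maybeList (L st))) (length (TR st)) ⟨
    length (AL st) ℕ.+ length (maybeList (L st)) ℕ.+ length (TR st)
      ≤⟨ ℕ.+-monoˡ-≤ (length (TR st)) (proj₁ (proj₂ bounds)) ⟩
    fedT st
      ≤⟨ proj₂ (proj₂ bounds) ⟩
    length S ∎

alg-length : ∀ f a n S → length (alg f a n S) ℕ.≤ length S
alg-length zero    a n S = z≤n
alg-length (suc f) a n S = length-largest-≤ (concatMap (candidates f a n S) (splitPoints n))
  (All.concat⁺ (All.map⁺ (All.universal (λ k → candidates-length-≤ f a n S k (alg-length f))
                                        (splitPoints n))))

maybeList-nonempty : ∀ {P : Interval → Set} {m} → Maybe.Any P m → 1 ℕ.≤ length (maybeList m)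
maybeList-nonempty (Maybe.just _) = s≤s z≤n

module _ (f : ℕ) (a : ℤ) (n : ℕ) (S : List Interval) {k : ℕ} (k∈ : k ∈ splitPoints n) where
  private
    st = splitState a n S k
    i  = a ℤ.+ + k
    open Run (fromℤ a) (fromℤ i) (fromℤ (a ℤ.+ + n))

    candidate-≤ : ∀ {c} → c ∈ candidates f a n S k → length c ℕ.≤ length (alg (suc f) a n S)
    candidate-≤ c∈ = length-≤-largest (concatMap (candidates f a n S) (splitPoints n))
                       (∈-concatMap⁺ (candidates f a n S) (Any.map (λ { refl → c∈ }) k∈))

  R-part-≤-alg : length (maybeList (R st)) ℕ.+ length (alg f i (n ∸ k) (AR st))
                 ℕ.≤ length (alg (suc f) a n S)
  R-part-≤-alg = ℕ.≤-trans (ℕ.m≤n+m _ (length (alg f a k (TL st)))) $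
    ℕ.≤-trans (ℕ.≤-reflexive (sym (length-++³ (alg f a k (TL st)) (maybeList (R st)) (alg f i (n ∸ k) (AR st)))))
              (candidate-≤ (here refl))

  L-part-≤-alg : length (alg f a k (AL st)) ℕ.+ length (maybeList (L st))
                 ℕ.≤ length (alg (suc f) a n S)
  L-part-≤-alg = ℕ.≤-trans (ℕ.m≤m+n _ (length (alg f i (n ∸ k) (TR st)))) $
    ℕ.≤-trans (ℕ.≤-reflexive (ℕ.+-assoc (length (alg f a k (AL st))) _ _)) $
    ℕ.≤-trans (ℕ.≤-reflexive (sym (length-++³ (alg f a k (AL st)) (maybeList (L st)) (alg f i (n ∸ k) (TR st)))))
              (candidate-≤ (there (here refl)))

  alg-nonempty-R : ∀ {y} → y ∈ S → Inside (fromℤ i) (fromℤ (a ℤ.+ + n)) y →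
                   1 ℕ.≤ length (alg (suc f) a n S)
  alg-nonempty-R y∈S iy =
    ℕ.≤-trans (ℕ.≤-trans (maybeList-nonempty (R≤-after initState y∈S iy)) (ℕ.m≤m+n _ _)) R-part-≤-alg

  alg-nonempty-L : ∀ {y} → y ∈ S → Inside (fromℤ a) (fromℤ i) y →
                   1 ℕ.≤ length (alg (suc f) a n S)
  alg-nonempty-L y∈S iy =
    ℕ.≤-trans (ℕ.≤-trans (maybeList-nonempty (≤L-after initState y∈S iy)) (ℕ.m≤n+m _ _)) L-part-≤-alg

  alg-pair-R : ∀ {r ℓ} → Precedes r ℓ S →
               Inside (fromℤ i) (fromℤ (a ℤ.+ + n)) r → Inside (fromℤ i) (fromℤ (a ℤ.+ + n)) ℓ →
               right r < ℓ →
               (∀ T → ℓ ∈ T → 1 ℕ.≤ length (alg f i (n ∸ k) T)) → 2 ℕ.≤ length (alg (suc f) a n S)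
  alg-pair-R r≺ℓ ir iℓ r<ℓ sub-nonempty = ℕ.≤-trans
    (ℕ.+-mono-≤ (maybeList-nonempty (R≤-after initState (Precedes⇒∈ r≺ℓ) ir))
                (sub-nonempty (AR st) (feeds-AR initState r≺ℓ ir iℓ r<ℓ)))
    R-part-≤-alg

  alg-pair-L : ∀ {r ℓ} → Precedes ℓ r S →
               Inside (fromℤ a) (fromℤ i) ℓ → Inside (fromℤ a) (fromℤ i) r → right r < ℓ →
               (∀ T → r ∈ T → 1 ℕ.≤ length (alg f a k T)) → 2 ℕ.≤ length (alg (suc f) a n S)
  alg-pair-L ℓ≺r iℓ ir r<ℓ sub-nonempty = ℕ.≤-trans
    (ℕ.+-mono-≤ (sub-nonempty (AL st) (feeds-AL initState ℓ≺r iℓ ir r<ℓ))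
                (maybeList-nonempty (≤L-after initState (Precedes⇒∈ ℓ≺r) iℓ)))
    L-part-≤-alg

InWindow : ℕ → Interval → Set
InWindow Δ = Inside 0ℚ (fromℤ (+ Δ))

-- Δ + 2 is not definitionally suc (suc Δ).
OUT≡alg : ∀ Δ S → OUT Δ S ≡ alg (suc (suc Δ)) -[1+ 0 ] (suc (suc Δ)) S
OUT≡alg Δ S = cong (λ m → alg m (ℤ.- (+ 1)) m S) (ℕ.+-comm Δ 2)

OUT-length-≤ : ∀ Δ S → length (OUT Δ S) ℕ.≤ length S
OUT-length-≤ Δ S = alg-length (Δ ℕ.+ 2) (ℤ.- (+ 1)) (Δ ℕ.+ 2) S

-1≤0 : fromℤ -[1+ 0 ] ≤ 0ℚ
-1≤0 = fromℤ-mono-≤ { -[1+ 0 ]} {+ 0} ℤ.-≤+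

OUT-≥-1 : ∀ Δ {S y} → y ∈ S → InWindow Δ y → 1 ℕ.≤ length (OUT Δ S)
OUT-≥-1 Δ {S} y∈S iy = subst (λ o → 1 ℕ.≤ length o) (sym (OUT≡alg Δ S)) $
  alg-nonempty-R (suc Δ) -[1+ 0 ] (suc (suc Δ)) S (suc-∈-splitPoints (s≤s z≤n)) y∈S
    (Inside-weaken ℚ.≤-refl (fromℤ-mono-≤ (ℤ.+≤+ (ℕ.n≤1+n Δ))) iy)

module _ (d : ℕ) {S : List Interval} {r ℓ : Interval} (ir : InWindow (suc d) r) (iℓ : InWindow (suc d) ℓ)
         (r<ℓ : right r < ℓ) where

  OUT-≥-2-left-first : Precedes r ℓ S →
                       2 ℕ.≤ length (alg (suc (suc (suc d))) -[1+ 0 ] (suc (suc (suc d))) S)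
  OUT-≥-2-left-first r≺ℓ =
    alg-pair-R (suc (suc d)) -[1+ 0 ] (suc (suc (suc d))) S (suc-∈-splitPoints (s≤s z≤n))
      r≺ℓ (widen ir) (widen iℓ) r<ℓ
      (λ T ℓ∈T → alg-nonempty-L (suc d) (+ 0) (suc (suc d)) T (suc-∈-splitPoints (ℕ.n<1+n d)) ℓ∈T iℓ)
    where
    widen : ∀ {x} → InWindow (suc d) x → Inside 0ℚ (fromℤ (+ suc (suc d))) x
    widen = Inside-weaken ℚ.≤-refl (fromℤ-mono-≤ (ℤ.+≤+ (ℕ.n≤1+n (suc d))))

  OUT-≥-2-right-first : Precedes ℓ r S →
                        2 ℕ.≤ length (alg (suc (suc (suc d))) -[1+ 0 ] (suc (suc (suc d))) S)
  OUT-≥-2-right-first ℓ≺r =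
    alg-pair-L (suc (suc d)) -[1+ 0 ] (suc (suc (suc d))) S (suc-∈-splitPoints (ℕ.n<1+n (suc d)))
      ℓ≺r (widen iℓ) (widen ir) r<ℓ
      (λ T r∈T → alg-nonempty-R (suc d) -[1+ 0 ] (suc (suc d)) T (suc-∈-splitPoints (s≤s z≤n)) r∈T ir)
    where
    widen : ∀ {x} → InWindow (suc d) x → Inside (fromℤ -[1+ 0 ]) (fromℤ (+ suc d)) x
    widen = Inside-weaken -1≤0 ℚ.≤-refl

  OUT-≥-2 : r ∈ S → ℓ ∈ S → 2 ℕ.≤ length (OUT (suc d) S)
  OUT-≥-2 r∈S ℓ∈S = subst (λ o → 2 ℕ.≤ length o) (sym (OUT≡alg (suc d) S)) $
    [ OUT-≥-2-left-first , OUT-≥-2-right-first ]′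
      (∈-precedes r∈S ℓ∈S (ℚ.<⇒≢ (ℚ.<-trans (<-right r) r<ℓ)))

insertAll-↭ : ∀ {A : Set} (x : A) ys {P} → P ∈ insertAll x ys → P ↭ x ∷ ys
insertAll-↭ x []       (here refl) = ↭-refl
insertAll-↭ x (y ∷ ys) (here refl) = ↭-refl
insertAll-↭ x (y ∷ ys) (there P∈) with P′ , P′∈ , refl ← ∈-map⁻ (y ∷_) P∈ =
  ↭-trans (↭-prep y (insertAll-↭ x ys P′∈)) (↭-swap y x ↭-refl)

perms-↭ : ∀ {A : Set} (xs : List A) {P} → P ∈ perms xs → P ↭ xs
perms-↭ []       (here refl) = ↭-refl
perms-↭ (x ∷ xs) P∈ with Q , Q∈ , P∈′ ← find (∈-concatMap⁻ (insertAll x) {xs = perms xs} P∈) =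
  ↭-trans (insertAll-↭ x Q P∈′) (↭-prep x (perms-↭ xs Q∈))

length-insertAll : ∀ {A : Set} (x : A) ys → length (insertAll x ys) ≡ suc (length ys)
length-insertAll x []       = refl
length-insertAll x (y ∷ ys) = cong suc (trans (length-map (y ∷_) (insertAll x ys)) (length-insertAll x ys))

length-concatMap-const : ∀ {A B : Set} (f : A → List B) c xs → (∀ {a} → a ∈ xs → length (f a) ≡ c) →
                         length (concatMap f xs) ≡ c ℕ.* length xs
length-concatMap-const f c []       _ = sym (ℕ.*-zeroʳ c)
length-concatMap-const f c (a ∷ xs) h = begin
  length (f a ++ concatMap f xs)
    ≡⟨ length-++ (f a) ⟩
  length (f a) ℕ.+ length (concatMap f xs)
    ≡⟨ cong₂ ℕ._+_ (h (here refl)) (length-concatMap-const f c xs (h ∘ there)) ⟩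
  c ℕ.+ c ℕ.* length xs
    ≡⟨ ℕ.*-suc c (length xs) ⟨
  c ℕ.* suc (length xs) ∎
  where open ≡-Reasoning

length-perms : ∀ {A : Set} (xs : List A) → length (perms xs) ≡ length xs !
length-perms []       = refl
length-perms (x ∷ xs) = trans
  (length-concatMap-const (insertAll x) (suc (length xs)) (perms xs)
    (λ {Q} Q∈ → trans (length-insertAll x Q) (cong suc (↭-length (perms-↭ xs Q∈)))))
  (cong (suc (length xs) ℕ.*_) (length-perms xs))

sum-map-≥ : ∀ {A : Set} (g : A → ℕ) {m} xs → All (λ a → m ℕ.≤ g a) xs →
            m ℕ.* length xs ℕ.≤ sum (map g xs)
sum-map-≥ g {m} []       []       = ℕ.≤-reflexive (ℕ.*-zeroʳ m)
sum-map-≥ g {m} (a ∷ xs) (m≤ ∷ h) =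
  ℕ.≤-trans (ℕ.≤-reflexive (ℕ.*-suc m (length xs))) (ℕ.+-mono-≤ m≤ (sum-map-≥ g xs h))

sum-map-≤ : ∀ {A : Set} (g : A → ℕ) {m} xs → All (λ a → g a ℕ.≤ m) xs →
            sum (map g xs) ℕ.≤ m ℕ.* length xs
sum-map-≤ g {m} []       []       = ℕ.≤-reflexive (sym (ℕ.*-zeroʳ m))
sum-map-≤ g {m} (a ∷ xs) (≤m ∷ h) =
  ℕ.≤-trans (ℕ.+-mono-≤ ≤m (sum-map-≤ g xs h)) (ℕ.≤-reflexive (sym (ℕ.*-suc m (length xs))))

module _ (Δ : ℕ) (I : List Interval) (m : ℕ) where
  private
    total : ℕ
    total = sum (map (λ S → length (OUT Δ S)) (perms I))

  expectedOut-≥ : (∀ {P} → P ∈ perms I → m ℕ.≤ length (OUT Δ P)) → + m / 1 ≤ expectedOut Δ I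
  expectedOut-≥ h = *≤*⇒/≤/ (+ m) (+ total) 1 (length I !) {{_}} {{length I ℕ.!≢0}}
    (subst₂ ℤ._≤_ (ℤ.pos-* m (length I !)) (sym (ℤ.*-identityʳ (+ total)))
      (ℤ.+≤+ (subst (λ c → m ℕ.* c ℕ.≤ total) (length-perms I) (sum-map-≥ _ (perms I) (All.tabulate h)))))

  expectedOut-≤ : (∀ {P} → P ∈ perms I → length (OUT Δ P) ℕ.≤ m) → expectedOut Δ I ≤ + m / 1
  expectedOut-≤ h = *≤*⇒/≤/ (+ total) (+ m) (length I !) 1 {{length I ℕ.!≢0}}
    (subst₂ ℤ._≤_ (sym (ℤ.*-identityʳ (+ total))) (ℤ.pos-* m (length I !))
      (ℤ.+≤+ (subst (λ c → total ℕ.≤ m ℕ.* c) (length-perms I) (sum-map-≤ _ (perms I) (All.tabulate h)))))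

Independent⇒≢ : Independent x y → x ≢ y
Independent⇒≢ (inj₁ x<y) refl = ℚ.<-asym x<y (<-right _)
Independent⇒≢ (inj₂ y<x) refl = ℚ.<-asym y<x (<-right _)

OUT-≥-independent : ∀ Δ → 1 ℕ.≤ Δ → ∀ {J S} → length J ℕ.≤ 2 → IndependentSet J → J ⊑ S → All (InWindow Δ) S →
                    length J ℕ.≤ length (OUT Δ S)
OUT-≥-independent Δ _ {[]} _ _ _ _ = z≤n
OUT-≥-independent Δ _ {y ∷ []} _ _ J⊑S window =
  OUT-≥-1 Δ (J⊑S (here refl)) (All.lookup window (J⊑S (here refl)))
OUT-≥-independent (suc d) _ {y ∷ z ∷ []} _ ((inj₁ y<z ∷ []) ∷ _) J⊑S window =
  OUT-≥-2 d (All.lookup window (J⊑S (here refl))) (All.lookup window (J⊑S (there (here refl)))) y<z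
    (J⊑S (here refl)) (J⊑S (there (here refl)))
OUT-≥-independent (suc d) _ {y ∷ z ∷ []} _ ((inj₂ z<y ∷ []) ∷ _) J⊑S window =
  OUT-≥-2 d (All.lookup window (J⊑S (there (here refl)))) (All.lookup window (J⊑S (here refl))) z<y
    (J⊑S (there (here refl))) (J⊑S (here refl))
OUT-≥-independent Δ _ {_ ∷ _ ∷ _ ∷ _} (s≤s (s≤s ())) _ _ _

expectedOut-lower : ∀ Δ → 1 ℕ.≤ Δ → ∀ {x} → x ℕ.≤ 2 → ∀ I → ValidInstance Δ I → HasAlpha I x →
                    + x / 1 ≤ expectedOut Δ I
expectedOut-lower Δ 1≤Δ x≤2 I (_ , window) ((K , K⊆I , K-indep , refl) , _) = expectedOut-≥ Δ I (length K) out-≥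
  where
  out-≥ : ∀ {P} → P ∈ perms I → length K ℕ.≤ length (OUT Δ P)
  out-≥ P∈ = OUT-≥-independent Δ 1≤Δ x≤2 K-indep (∈-resp-↭ I↭P ∘ Sublist.lookup K⊆I) (All-resp-↭ I↭P window)
    where
    I↭P = ↭-sym (perms-↭ I P∈)

expectedOut-upper : ∀ Δ I → expectedOut Δ I ≤ + length I / 1
expectedOut-upper Δ I = expectedOut-≤ Δ I (length I) λ P∈ →
  ℕ.≤-trans (OUT-length-≤ Δ _) (ℕ.≤-reflexive (↭-length (perms-↭ I P∈)))

independent-ValidInstance : ∀ Δ {I J} → J ⊆ I → ValidInstance Δ I → IndependentSet J → ValidInstance Δ J
independent-ValidInstance Δ J⊆I (_ , window) J-indep = AllPairs.map Independent⇒≢ J-indep , All-resp-⊆ J⊆I window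

independent-HasAlpha : ∀ {J} → IndependentSet J → HasAlpha J (length J)
independent-HasAlpha {J} J-indep = (J , ⊆-refl , J-indep , refl) , λ S S⊆J _ → length-mono-≤ S⊆J

lemma2 : (Δ : ℕ) → 1 ℕ.≤ Δ → (x : ℕ) → x ℕ.≤ 2
    → Σ (List Interval) (λ I → ValidInstance Δ I × HasAlpha I x)
    → ((I : List Interval) → ValidInstance Δ I → HasAlpha I x
         → (+ x / 1) ≤ expectedOut Δ I)
      × Σ (List Interval) (λ I → ValidInstance Δ I × HasAlpha I x
           × expectedOut Δ I ≡ + x / 1)
lemma2 Δ 1≤Δ _ x≤2 (_ , valid , (J , J⊆I , J-indep , refl) , _) =
  expectedOut-lower Δ 1≤Δ x≤2 , J , J-valid , J-α ,
  ℚ.≤-antisym (expectedOut-upper Δ J) (expectedOut-lower Δ 1≤Δ x≤2 J J-valid J-α)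
  where
  J-valid : ValidInstance Δ J
  J-valid = independent-ValidInstance Δ J⊆I valid J-indep
  J-α : HasAlpha J (length J)
  J-α = independent-HasAlpha J-indep
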